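{- For all integers $n\geq 1$ and $0\leq k\leq n-1$, the number of ascent sequences $e\in\mathcal{A}_n$ that avoid the vincular pattern $\underline{12}0$ and satisfy $\mathrm{asc}(e)=k$ equals $$T(n,k)=\binom{\binom{k+2}{2}+n-k-2}{n-k-1}.$$
   Context: An inversion sequence of length $n$ is an integer sequence $e=e_1e_2\ldots e_n$ with $0\leq e_i<i$ for all $1\le i\le n$. For a sequence $e_1\ldots e_i$, $\mathrm{asc}(e_1\ldots e_i)=|\{\ell\in[i-1]: e_\ell<e_{\ell+1}\}|$ is its number of ascents. The set $\mathcal{A}_n$ of ascent sequences of length $n$ consists of the inversion sequences $e$ of length $n$ with $e_{i+1}\leq \mathrm{asc}(e_1\ldots e_i)+1$ for all $1\le i<n$. A sequence $e$ avoids $\underline{12}0$ if there are no indices $2\leq i<j\leq n$ with $e_j<e_{i-1}<e_i$. -}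

module Defs where

open import Data.Nat using (ℕ; zero; suc; _+_; _∸_; _<ᵇ_; _≤ᵇ_)
open import Data.Nat.Combinatorics using (_C_)
open import Data.Bool using (Bool; true; false; _∧_; not)
open import Data.List using (List; []; _∷_; length; take; upTo; map)
open import Data.Vec using (Vec; toList)

-- 1-indexed entry e_i of a finite sequence (value 0 outside [1,length]; only
-- ever used with 1 ≤ i ≤ length)
_!_ : List ℕ → ℕ → ℕ
[]      ! _           = 0
(x ∷ xs) ! zero       = 0
(x ∷ xs) ! suc zero   = x
(x ∷ xs) ! suc (suc i) = xs ! suc i

all : {A : Set} → (A → Bool) → List A → Bool
all P []       = true
all P (x ∷ xs) = P x ∧ all P xs

range : ℕ → ℕ → List ℕ
range a b = map (a +_) (upTo (suc b ∸ a))

countB : (ℕ → Bool) → List ℕ → ℕ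
countB P []       = 0
countB P (x ∷ xs) with P x
... | true  = suc (countB P xs)
... | false = countB P xs

asc : List ℕ → ℕ
asc e = countB (λ ℓ → (e ! ℓ) <ᵇ (e ! suc ℓ)) (range 1 (length e ∸ 1))

isInversionSeq : List ℕ → Bool
isInversionSeq e = all (λ i → (e ! i) <ᵇ i) (range 1 (length e))

isAscentSeq : List ℕ → Bool
isAscentSeq e = isInversionSeq e
  ∧ all (λ i → (e ! suc i) ≤ᵇ suc (asc (take i e))) (range 1 (length e ∸ 1))

avoids120 : List ℕ → Bool
avoids120 e = all (λ i → all (λ j →
    not (((e ! j) <ᵇ (e ! (i ∸ 1))) ∧ ((e ! (i ∸ 1)) <ᵇ (e ! i))))
    (range (suc i) (length e)))
  (range 2 (length e))

-- T(n,k) = C( C(k+2,2) + n - k - 2 , n - k - 1 )   (for 0 ≤ k ≤ n-1 the upper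
-- argument C(k+2,2)+n-k-2 ≥ 0, so truncated subtraction is exact)
T : ℕ → ℕ → ℕ
T n k = ((suc (suc k) C 2) + n ∸ (k + 2)) C (n ∸ (k + 1))

-- the set {e ∈ 𝒜_n : e avoids 12̲0 and asc(e) = k}, as a subset of Vec ℕ n
-- (all defining conditions are Bool/ℕ equalities, hence proof-irrelevant)
Counted : ℕ → ℕ → Set
Counted n k = Data.Product.Σ (Vec ℕ n) λ e →
  isAscentSeq (toList e) ≡ true × avoids120 (toList e) ≡ true × asc (toList e) ≡ k
  where open import Data.Product using (_×_)
        open import Relation.Binary.PropositionalEquality using (_≡_)
        import Data.Product

module Submission where

-- Ascent sequences avoiding 12̲0 with k ascents and N weak descents (so
-- n = N + k + 1 entries) number C(C(k+2,2) + N - 1, N) = T(n,k).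
--
-- Avoiding 12̲0 means that after an ascent a < b no later entry
-- lies below a.  So such a sequence grows from 0 entry by entry, remembering
-- its last entry ℓ and its floor m (the lower entry of the latest ascent):
-- the next entry is x ∈ [m, ℓ] (a weak descent) or x ∈ (ℓ, k + 1] (an ascent,
-- after which ℓ is the floor).  The family Built records such derivations.
-- Lemmas on how the Boolean definitions of Defs change when one entry is
-- appended (module Append) show that derivations are sound, complete and
-- unique, hence in bijection with the counted set (derivations↔counted).
--
-- In generating-function form, with cumul the partial
-- sums (multiplication by 1/(1 - z)), the last-step recursion yields the
-- identity endBelow-endAt, whence the series of all derivations with k
-- ascents is 1/(1 - z)^C(k+2,2) (total-cumul); its coefficients are T(n,k).

open import Defs
open import Data.Nat using (ℕ; zero; suc; _+_; _∸_; _≤_; _<_; z≤n; s≤s; _<ᵇ_; _≤ᵇ_)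
open import Data.Nat.Properties
open import Data.Nat.Combinatorics using (_C_; nCn≡1; nC1≡n; nCk+nC[k+1]≡[n+1]C[k+1])
open import Data.Nat.Tactic.RingSolver using (solve-∀)
open import Data.Bool using (Bool; true; false; _∧_; not) renaming (T to IsTrue)
open import Data.Bool.Properties using (T-≡; ∧-zeroʳ; ∧-identityʳ; ∧-assoc)
open import Data.List using (List; []; _∷_; [_]; length; take; upTo; map; _∷ʳ_)
open import Data.List.Properties using (upTo-∷ʳ; map-++; length-map; length-upTo; take-all; ∷ʳ-injective; ∷ʳ-injectiveˡ)
open import Data.List.Membership.Propositional using (_∈_)
open import Data.List.Membership.Propositional.Properties using (∈-map⁻; ∈-upTo⁻)
open import Data.List.Relation.Unary.Any using (here; there)
open import Data.List.Reverse using (Reverse; []; _∶_∶ʳ_; reverseView)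
open import Data.Vec using (Vec; toList; fromList; cast)
open import Data.Vec.Properties using (toList-cast; toList∘fromList; toList-injective; cast-is-id; length-toList)
open import Data.Fin using (Fin; zero)
open import Data.Fin.Properties using (+↔⊎; 0↔⊥)
open import Data.Product using (Σ-syntax; _×_; _,_; proj₁; proj₂)
open import Data.Product.Function.NonDependent.Propositional using (_×-↔_)
open import Data.Sum using (_⊎_; inj₁; inj₂)
open import Data.Sum.Function.Propositional using (_⊎-↔_)
open import Data.Unit using (⊤; tt)
open import Data.Empty using (⊥; ⊥-elim)
open import Function using (_∘_)
open import Function.Bundles using (Equivalence; _↔_; mk↔ₛ′)
open import Function.Properties.Inverse using (↔-trans; ↔-sym; ↔-refl)
open import Axiom.UniquenessOfIdentityProofs.WithK using (uip)
open import Relation.Nullary using (Dec; yes; no; ¬_; contradiction)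
open import Relation.Binary.PropositionalEquality hiding ([_])

private
  variable
    a i m n t N k ℓ N′ k′ m′ ℓ′ : ℕ
    xs : List ℕ
    P Q : ℕ → Bool

<ᵇ-true : m < n → (m <ᵇ n) ≡ true
<ᵇ-true m<n = Equivalence.to T-≡ (<⇒<ᵇ m<n)

<ᵇ-false : n ≤ m → (m <ᵇ n) ≡ false
<ᵇ-false {n} {m} n≤m with m <ᵇ n in eq
... | false = refl
... | true  = contradiction (<ᵇ⇒< m n (subst IsTrue (sym eq) _)) (≤⇒≯ n≤m)

≤ᵇ-true : m ≤ n → (m ≤ᵇ n) ≡ true
≤ᵇ-true m≤n = Equivalence.to T-≡ (≤⇒≤ᵇ m≤n)

≤ᵇ-false : n < m → (m ≤ᵇ n) ≡ false
≤ᵇ-false (s≤s n≤m) = <ᵇ-false n≤m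

≤ᵇ-true⁻¹ : (m ≤ᵇ n) ≡ true → m ≤ n
≤ᵇ-true⁻¹ {m} {n} eq = ≤ᵇ⇒≤ m n (Equivalence.from T-≡ eq)

∧-true⁻¹ : ∀ {b c} → b ∧ c ≡ true → b ≡ true × c ≡ true
∧-true⁻¹ {true} {true} _ = refl , refl

∧-interchange : ∀ b c d f → (b ∧ c) ∧ (d ∧ f) ≡ (b ∧ d) ∧ (c ∧ f)
∧-interchange true  true  d f = refl
∧-interchange true  false d f = sym (∧-zeroʳ d)
∧-interchange false c     d f = refl

∧-drop-implied : ∀ b c d f → (f ≡ true → c ≡ true) → (b ∧ c) ∧ (d ∧ f) ≡ (b ∧ d) ∧ f
∧-drop-implied false c d f     _ = refl
∧-drop-implied true  c d true  h rewrite h refl = refl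
∧-drop-implied true  c d false _ = trans (cong (c ∧_) (∧-zeroʳ d)) (trans (∧-zeroʳ c) (sym (∧-zeroʳ d)))

indicator : Bool → ℕ
indicator true  = 1
indicator false = 0

-- Integer intervals; Defs writes  range a b  for  interval a (b + 1 ∸ a).

interval : ℕ → ℕ → List ℕ
interval a t = map (a +_) (upTo t)

interval-suc : ∀ a t → interval a (suc t) ≡ interval a t ∷ʳ (a + t)
interval-suc a t = begin
  map (a +_) (upTo (suc t))   ≡⟨ cong (map (a +_)) (sym (upTo-∷ʳ t)) ⟩
  map (a +_) (upTo t ∷ʳ t)    ≡⟨ map-++ (a +_) (upTo t) [ t ] ⟩
  interval a t ∷ʳ (a + t)     ∎
  where open ≡-Reasoning

∈-interval⁻ : i ∈ interval a t → a ≤ i × i < a + t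
∈-interval⁻ {a = a} i∈ with ∈-map⁻ (a +_) i∈
... | j , j∈ , refl = m≤m+n a j , +-monoʳ-< a (∈-upTo⁻ j∈)

length-interval : ∀ a t → length (interval a t) ≡ t
length-interval a t = trans (length-map (a +_) (upTo t)) (length-upTo t)

all-∷ʳ : ∀ (P : ℕ → Bool) xs y → all P (xs ∷ʳ y) ≡ all P xs ∧ P y
all-∷ʳ P []       y = ∧-identityʳ (P y)
all-∷ʳ P (x ∷ xs) y = trans (cong (P x ∧_) (all-∷ʳ P xs y)) (sym (∧-assoc (P x) _ _))

countB-∷ʳ : ∀ P xs y → countB P (xs ∷ʳ y) ≡ countB P xs + indicator (P y)
countB-∷ʳ P [] y with P y
... | true  = refl
... | false = refl
countB-∷ʳ P (x ∷ xs) y with P x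
... | true  = cong suc (countB-∷ʳ P xs y)
... | false = countB-∷ʳ P xs y

countB-≤-length : ∀ P xs → countB P xs ≤ length xs
countB-≤-length P [] = z≤n
countB-≤-length P (x ∷ xs) with P x
... | true  = s≤s (countB-≤-length P xs)
... | false = m≤n⇒m≤1+n (countB-≤-length P xs)

all-cong : (∀ {i} → i ∈ xs → P i ≡ Q i) → all P xs ≡ all Q xs
all-cong {[]}     h = refl
all-cong {x ∷ xs} h = cong₂ _∧_ (h (here refl)) (all-cong (h ∘ there))

countB-cong : (∀ {i} → i ∈ xs → P i ≡ Q i) → countB P xs ≡ countB Q xs
countB-cong {x ∷ xs} {P} {Q} h with P x | Q x | h (here refl)
... | true  | .true  | refl = cong suc (countB-cong (h ∘ there))
... | false | .false | refl = countB-cong (h ∘ there)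
countB-cong {[]} h = refl

all-∧ : ∀ (P Q : ℕ → Bool) xs → all (λ i → P i ∧ Q i) xs ≡ all P xs ∧ all Q xs
all-∧ P Q []       = refl
all-∧ P Q (x ∷ xs) =
  trans (cong ((P x ∧ Q x) ∧_) (all-∧ P Q xs)) (∧-interchange (P x) (Q x) (all P xs) (all Q xs))

all-interval-suc : (∀ {i} → i ∈ interval a t → P i ≡ Q i) →
                   all P (interval a (suc t)) ≡ all Q (interval a t) ∧ P (a + t)
all-interval-suc {a} {t} {P} h =
  trans (cong (all P) (interval-suc a t))
        (trans (all-∷ʳ P (interval a t) (a + t)) (cong (_∧ P (a + t)) (all-cong h)))

countB-interval-suc : (∀ {i} → i ∈ interval a t → P i ≡ Q i) →
                      countB P (interval a (suc t)) ≡ countB Q (interval a t) + indicator (P (a + t))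
countB-interval-suc {a} {t} {P} h =
  trans (cong (countB P) (interval-suc a t))
        (trans (countB-∷ʳ P (interval a t) (a + t)) (cong (_+ indicator (P (a + t))) (countB-cong h)))

length-∷ʳ : ∀ (e : List ℕ) x → length (e ∷ʳ x) ≡ suc (length e)
length-∷ʳ []      x = refl
length-∷ʳ (y ∷ e) x = cong suc (length-∷ʳ e x)

!-∷ʳ : ∀ e x {i} → i ≤ length e → (e ∷ʳ x) ! i ≡ e ! i
!-∷ʳ []      x {zero}        _         = refl
!-∷ʳ (y ∷ e) x {zero}        _         = refl
!-∷ʳ (y ∷ e) x {suc zero}    _         = refl
!-∷ʳ (y ∷ e) x {suc (suc i)} (s≤s i<) = !-∷ʳ e x i<

!-∷ʳ-new : ∀ e x → (e ∷ʳ x) ! suc (length e) ≡ x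
!-∷ʳ-new []      x = refl
!-∷ʳ-new (y ∷ e) x = !-∷ʳ-new e x

take-∷ʳ : ∀ (e : List ℕ) (x : ℕ) {i} → i ≤ length e → take i (e ∷ʳ x) ≡ take i e
take-∷ʳ e       x {zero}  _        = refl
take-∷ʳ (y ∷ e) x {suc i} (s≤s i≤) = cong (y ∷_) (take-∷ʳ e x i≤)

-- The index-wise tests out of which Defs builds asc, isInversionSeq,
-- isAscentSeq and avoids120 (each of those is, by definition, an all/countB
-- of the corresponding test over an interval).

ascentAt : List ℕ → ℕ → Bool
ascentAt e i = (e ! i) <ᵇ (e ! suc i)

inversionAt : List ℕ → ℕ → Bool
inversionAt e i = (e ! i) <ᵇ i

ascentBoundAt : List ℕ → ℕ → Bool
ascentBoundAt e i = (e ! suc i) ≤ᵇ suc (asc (take i e))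

ascentAbove : List ℕ → ℕ → ℕ → Bool
ascentAbove e i y = (y <ᵇ e ! (i ∸ 1)) ∧ (e ! (i ∸ 1) <ᵇ e ! i)

clearAfter : List ℕ → ℕ → Bool
clearAfter e i = all (λ j → not (ascentAbove e i (e ! j))) (interval (suc i) (length e ∸ i))

-- y may be appended to e without creating 12̲0: no ascent of e has its lower
-- entry above y
admits : List ℕ → ℕ → Bool
admits e y = all (λ i → not (ascentAbove e i y)) (interval 2 (length e ∸ 1))

asc-≤ : ∀ e → asc e ≤ length e ∸ 1
asc-≤ e = ≤-trans (countB-≤-length (ascentAt e) (interval 1 (length e ∸ 1))) (≤-reflexive (length-interval 1 (length e ∸ 1)))

clearAfter-end : ∀ e → clearAfter e (length e) ≡ true
clearAfter-end e = cong (λ t → all (λ j → not (ascentAbove e (length e) (e ! j))) (interval (suc (length e)) t))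
                        (n∸n≡0 (length e))

module Append (e : List ℕ) (x : ℕ) {p : ℕ} (length≡ : length e ≡ suc p) where

  length⁺ : length (e ∷ʳ x) ≡ suc (suc p)
  length⁺ = trans (length-∷ʳ e x) (cong suc length≡)

  old : ∀ {i} → i ≤ suc p → (e ∷ʳ x) ! i ≡ e ! i
  old {i} i≤ = !-∷ʳ e x (subst (i ≤_) (sym length≡) i≤)

  new : (e ∷ʳ x) ! suc (suc p) ≡ x
  new = subst (λ L → (e ∷ʳ x) ! suc L ≡ x) length≡ (!-∷ʳ-new e x)

  asc-append : asc (e ∷ʳ x) ≡ asc e + indicator ((e ! suc p) <ᵇ x)
  asc-append = begin
    asc (e ∷ʳ x)
      ≡⟨ cong (λ L → countB (ascentAt (e ∷ʳ x)) (interval 1 (L ∸ 1))) length⁺ ⟩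
    countB (ascentAt (e ∷ʳ x)) (interval 1 (suc p))
      ≡⟨ countB-interval-suc {1} {p} oldAscent ⟩
    countB (ascentAt e) (interval 1 p) + indicator (ascentAt (e ∷ʳ x) (suc p))
      ≡⟨ cong₂ _+_ (cong (λ L → countB (ascentAt e) (interval 1 (L ∸ 1))) (sym length≡))
                   (cong indicator (cong₂ _<ᵇ_ (old ≤-refl) new)) ⟩
    asc e + indicator ((e ! suc p) <ᵇ x) ∎
    where
    open ≡-Reasoning
    oldAscent : ∀ {i} → i ∈ interval 1 p → ascentAt (e ∷ʳ x) i ≡ ascentAt e i
    oldAscent i∈ with _ , i<1+p ← ∈-interval⁻ i∈ =
      cong₂ _<ᵇ_ (old (≤-trans (n≤1+n _) i<1+p)) (old i<1+p)

  asc-append-descent : x ≤ e ! suc p → asc (e ∷ʳ x) ≡ asc e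
  asc-append-descent x≤ =
    trans asc-append (trans (cong (λ b → asc e + indicator b) (<ᵇ-false x≤)) (+-identityʳ (asc e)))

  asc-append-ascent : e ! suc p < x → asc (e ∷ʳ x) ≡ suc (asc e)
  asc-append-ascent <x =
    trans asc-append (trans (cong (λ b → asc e + indicator b) (<ᵇ-true <x)) (+-comm (asc e) 1))

  isInversionSeq-append : isInversionSeq (e ∷ʳ x) ≡ isInversionSeq e ∧ (x <ᵇ suc (suc p))
  isInversionSeq-append = begin
    isInversionSeq (e ∷ʳ x)
      ≡⟨ cong (λ L → all (inversionAt (e ∷ʳ x)) (interval 1 L)) length⁺ ⟩
    all (inversionAt (e ∷ʳ x)) (interval 1 (suc (suc p)))
      ≡⟨ all-interval-suc {1} {suc p} {inversionAt (e ∷ʳ x)} {inversionAt e} (λ {i} i∈ → cong (_<ᵇ i) (old (≤-pred (proj₂ (∈-interval⁻ i∈))))) ⟩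
    all (inversionAt e) (interval 1 (suc p)) ∧ inversionAt (e ∷ʳ x) (suc (suc p))
      ≡⟨ cong₂ _∧_ (cong (λ L → all (inversionAt e) (interval 1 L)) (sym length≡))
                   (cong (_<ᵇ suc (suc p)) new) ⟩
    isInversionSeq e ∧ (x <ᵇ suc (suc p)) ∎
    where open ≡-Reasoning

  -- Appending keeps an ascent sequence exactly when x ≤ asc e + 1; the
  -- inversion-sequence bound x < p + 2 is then automatic since asc e ≤ p.
  isAscentSeq-append : isAscentSeq (e ∷ʳ x) ≡ isAscentSeq e ∧ (x ≤ᵇ suc (asc e))
  isAscentSeq-append = begin
    isAscentSeq (e ∷ʳ x)
      ≡⟨ cong₂ _∧_ isInversionSeq-append
                   (cong (λ L → all (ascentBoundAt (e ∷ʳ x)) (interval 1 (L ∸ 1))) length⁺) ⟩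
    (isInversionSeq e ∧ (x <ᵇ suc (suc p))) ∧ all (ascentBoundAt (e ∷ʳ x)) (interval 1 (suc p))
      ≡⟨ cong ((isInversionSeq e ∧ (x <ᵇ suc (suc p))) ∧_) (all-interval-suc {1} {p} oldBound) ⟩
    (isInversionSeq e ∧ (x <ᵇ suc (suc p))) ∧ (all (ascentBoundAt e) (interval 1 p) ∧ ascentBoundAt (e ∷ʳ x) (suc p))
      ≡⟨ cong (λ b → (isInversionSeq e ∧ (x <ᵇ suc (suc p))) ∧ (all (ascentBoundAt e) (interval 1 p) ∧ b)) newBound ⟩
    (isInversionSeq e ∧ (x <ᵇ suc (suc p))) ∧ (all (ascentBoundAt e) (interval 1 p) ∧ (x ≤ᵇ suc (asc e)))
      ≡⟨ ∧-drop-implied (isInversionSeq e) (x <ᵇ suc (suc p)) (all (ascentBoundAt e) (interval 1 p)) (x ≤ᵇ suc (asc e)) implied ⟩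
    (isInversionSeq e ∧ all (ascentBoundAt e) (interval 1 p)) ∧ (x ≤ᵇ suc (asc e))
      ≡⟨ cong (λ L → (isInversionSeq e ∧ all (ascentBoundAt e) (interval 1 (L ∸ 1))) ∧ (x ≤ᵇ suc (asc e)))
              (sym length≡) ⟩
    isAscentSeq e ∧ (x ≤ᵇ suc (asc e)) ∎
    where
    open ≡-Reasoning
    oldBound : ∀ {i} → i ∈ interval 1 p → ascentBoundAt (e ∷ʳ x) i ≡ ascentBoundAt e i
    oldBound {i} i∈ with _ , i<1+p ← ∈-interval⁻ i∈ =
      cong₂ _≤ᵇ_ (old i<1+p)
                 (cong (suc ∘ asc) (take-∷ʳ e x (subst (i ≤_) (sym length≡) (≤-trans (n≤1+n _) i<1+p))))
    newBound : ascentBoundAt (e ∷ʳ x) (suc p) ≡ (x ≤ᵇ suc (asc e))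
    newBound = cong₂ _≤ᵇ_ new (cong (suc ∘ asc)
      (trans (take-∷ʳ e x (≤-reflexive (sym length≡))) (take-all (suc p) e (≤-reflexive length≡))))
    implied : (x ≤ᵇ suc (asc e)) ≡ true → (x <ᵇ suc (suc p)) ≡ true
    implied h = <ᵇ-true (s≤s (≤-trans (≤ᵇ-true⁻¹ {x} h) (s≤s (subst (λ L → asc e ≤ L ∸ 1) length≡ (asc-≤ e)))))

  ascentAbove-append : ∀ {i y} → i ≤ suc p → ascentAbove (e ∷ʳ x) i y ≡ ascentAbove e i y
  ascentAbove-append {i} {y} i≤ = cong₂ _∧_ (cong (y <ᵇ_) below) (cong₂ _<ᵇ_ below (old i≤))
    where
    below : (e ∷ʳ x) ! (i ∸ 1) ≡ e ! (i ∸ 1)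
    below = old (≤-trans (m∸n≤m i 1) i≤)

  admits-append : ∀ y → admits (e ∷ʳ x) y ≡ admits e y ∧ not ((y <ᵇ e ! suc p) ∧ (e ! suc p <ᵇ x))
  admits-append y = begin
    admits (e ∷ʳ x) y
      ≡⟨ cong (λ L → all (λ i → not (ascentAbove (e ∷ʳ x) i y)) (interval 2 (L ∸ 1))) length⁺ ⟩
    all (λ i → not (ascentAbove (e ∷ʳ x) i y)) (interval 2 (suc p))
      ≡⟨ all-interval-suc {2} {p} (λ i∈ → cong not (ascentAbove-append (≤-pred (proj₂ (∈-interval⁻ i∈))))) ⟩
    all (λ i → not (ascentAbove e i y)) (interval 2 p) ∧ not (ascentAbove (e ∷ʳ x) (suc (suc p)) y)
      ≡⟨ cong₂ _∧_ (cong (λ L → all (λ i → not (ascentAbove e i y)) (interval 2 (L ∸ 1))) (sym length≡))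
                   (cong not (cong₂ _∧_ (cong (y <ᵇ_) (old ≤-refl)) (cong₂ _<ᵇ_ (old ≤-refl) new))) ⟩
    admits e y ∧ not ((y <ᵇ e ! suc p) ∧ (e ! suc p <ᵇ x)) ∎
    where open ≡-Reasoning

  clearAfter-append : ∀ {i} → i ≤ suc p → clearAfter (e ∷ʳ x) i ≡ clearAfter e i ∧ not (ascentAbove e i x)
  clearAfter-append {i} i≤ = begin
    clearAfter (e ∷ʳ x) i
      ≡⟨ cong (λ t → all (λ j → not (ascentAbove (e ∷ʳ x) i ((e ∷ʳ x) ! j))) (interval (suc i) t))
              (trans (cong (_∸ i) length⁺) (+-∸-assoc 1 i≤)) ⟩
    all (λ j → not (ascentAbove (e ∷ʳ x) i ((e ∷ʳ x) ! j))) (interval (suc i) (suc (suc p ∸ i)))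
      ≡⟨ all-interval-suc {suc i} {suc p ∸ i} oldEntry ⟩
    all (λ j → not (ascentAbove e i (e ! j))) (interval (suc i) (suc p ∸ i))
      ∧ not (ascentAbove (e ∷ʳ x) i ((e ∷ʳ x) ! (suc i + (suc p ∸ i))))
      ≡⟨ cong₂ _∧_ (cong (λ L → all (λ j → not (ascentAbove e i (e ! j))) (interval (suc i) (L ∸ i))) (sym length≡))
                   (cong not (trans (cong (ascentAbove (e ∷ʳ x) i) newEntry) (ascentAbove-append i≤))) ⟩
    clearAfter e i ∧ not (ascentAbove e i x) ∎
    where
    open ≡-Reasoning
    end≡ : suc i + (suc p ∸ i) ≡ suc (suc p)
    end≡ = cong suc (m+[n∸m]≡n i≤)
    oldEntry : ∀ {j} → j ∈ interval (suc i) (suc p ∸ i) →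
               not (ascentAbove (e ∷ʳ x) i ((e ∷ʳ x) ! j)) ≡ not (ascentAbove e i (e ! j))
    oldEntry {j} j∈ with _ , j< ← ∈-interval⁻ j∈ =
      cong not (trans (ascentAbove-append i≤) (cong (ascentAbove e i) (old (≤-pred (subst (j <_) end≡ j<)))))
    newEntry : (e ∷ʳ x) ! (suc i + (suc p ∸ i)) ≡ x
    newEntry = trans (cong ((e ∷ʳ x) !_) end≡) new

  avoids120-append : avoids120 (e ∷ʳ x) ≡ avoids120 e ∧ admits e x
  avoids120-append = begin
    avoids120 (e ∷ʳ x)
      ≡⟨ cong (λ L → all (clearAfter (e ∷ʳ x)) (interval 2 (L ∸ 1))) length⁺ ⟩
    all (clearAfter (e ∷ʳ x)) (interval 2 (suc p))
      ≡⟨ all-interval-suc {2} {p} (λ i∈ → clearAfter-append (≤-pred (proj₂ (∈-interval⁻ i∈)))) ⟩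
    all (λ i → clearAfter e i ∧ not (ascentAbove e i x)) (interval 2 p) ∧ clearAfter (e ∷ʳ x) (suc (suc p))
      ≡⟨ cong₂ _∧_ (all-∧ (clearAfter e) (λ i → not (ascentAbove e i x)) (interval 2 p))
                   (subst (λ L → clearAfter (e ∷ʳ x) L ≡ true) length⁺ (clearAfter-end (e ∷ʳ x))) ⟩
    (all (clearAfter e) (interval 2 p) ∧ all (λ i → not (ascentAbove e i x)) (interval 2 p)) ∧ true
      ≡⟨ ∧-identityʳ _ ⟩
    all (clearAfter e) (interval 2 p) ∧ all (λ i → not (ascentAbove e i x)) (interval 2 p)
      ≡⟨ cong (λ L → all (clearAfter e) (interval 2 (L ∸ 1)) ∧ all (λ i → not (ascentAbove e i x)) (interval 2 (L ∸ 1)))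
              (sym length≡) ⟩
    avoids120 e ∧ admits e x ∎
    where open ≡-Reasoning

-- Built N k m ℓ: ascent sequences avoiding 12̲0, generated entry by entry,
-- with N weak descents, k ascents, last entry ℓ and floor m, the lower entry
-- of the most recent ascent (0 if there is none).  Avoiding 12̲0 says
-- precisely that no entry drops below the current floor, and the ascent
-- condition that an ascent goes at most to k + 1.
data Built : ℕ → ℕ → ℕ → ℕ → Set where
  start   : Built 0 0 0 0
  descend : ∀ {N k m ℓ} → Built N k m ℓ → (x : ℕ) → m ≤ x → x ≤ ℓ → Built (suc N) k m x
  ascend  : ∀ {N k m ℓ} → Built N k m ℓ → (x : ℕ) → ℓ < x → x ≤ suc k → Built N (suc k) ℓ x

entries : Built N k m ℓ → List ℕ
entries start             = [ 0 ]
entries (descend s x _ _) = entries s ∷ʳ x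
entries (ascend s x _ _)  = entries s ∷ʳ x

record Sound (s : Built N k m ℓ) : Set where
  field
    length≡ : length (entries s) ≡ suc (N + k)
    last≡   : entries s ! suc (N + k) ≡ ℓ
    asc≡    : asc (entries s) ≡ k
    ascent  : isAscentSeq (entries s) ≡ true
    avoids  : avoids120 (entries s) ≡ true
    admits≡ : ∀ y → admits (entries s) y ≡ (m ≤ᵇ y)
    m≤ℓ     : m ≤ ℓ
    ℓ≤k     : ℓ ≤ k

admits-after-ascent : ∀ y → m ≤ ℓ → (m ≤ᵇ y) ∧ not ((y <ᵇ ℓ) ∧ true) ≡ (ℓ ≤ᵇ y)
admits-after-ascent {m} {ℓ} y m≤ℓ with ℓ ≤? y
... | yes ℓ≤y rewrite ≤ᵇ-true (≤-trans m≤ℓ ℓ≤y) | <ᵇ-false ℓ≤y | ≤ᵇ-true ℓ≤y = refl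
... | no ℓ≰y  rewrite <ᵇ-true (≰⇒> ℓ≰y) | ≤ᵇ-false (≰⇒> ℓ≰y) = ∧-zeroʳ (m ≤ᵇ y)

sound-descend : {s : Built N k m ℓ} → Sound s → ∀ x (m≤x : m ≤ x) (x≤ℓ : x ≤ ℓ) →
                Sound (descend s x m≤x x≤ℓ)
sound-descend {N} {k} {m} {ℓ} {s} S x m≤x x≤ℓ = record
  { length≡ = length⁺
  ; last≡   = new
  ; asc≡    = trans (asc-append-descent (subst (x ≤_) (sym last≡) x≤ℓ)) asc≡
  ; ascent  = trans isAscentSeq-append
                    (cong₂ _∧_ ascent (≤ᵇ-true (m≤n⇒m≤1+n (subst (x ≤_) (sym asc≡) (≤-trans x≤ℓ ℓ≤k)))))
  ; avoids  = trans avoids120-append (cong₂ _∧_ avoids (trans (admits≡ x) (≤ᵇ-true m≤x)))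
  ; admits≡ = λ y → trans (admits-append y) (admitsUnchanged y)
  ; m≤ℓ     = m≤x
  ; ℓ≤k     = ≤-trans x≤ℓ ℓ≤k
  }
  where
  open Sound S
  open Append (entries s) x length≡
  -- a weak descent is not an ascent, so it creates no new obstruction
  admitsUnchanged : ∀ y → admits (entries s) y ∧ not ((y <ᵇ entries s ! suc (N + k)) ∧ (entries s ! suc (N + k) <ᵇ x))
                          ≡ (m ≤ᵇ y)
  admitsUnchanged y rewrite last≡ | <ᵇ-false x≤ℓ | ∧-zeroʳ (y <ᵇ ℓ) | ∧-identityʳ (admits (entries s) y) = admits≡ y

sound-ascend : {s : Built N k m ℓ} → Sound s → ∀ x (ℓ<x : ℓ < x) (x≤1+k : x ≤ suc k) →
               Sound (ascend s x ℓ<x x≤1+k)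
sound-ascend {N} {k} {m} {ℓ} {s} S x ℓ<x x≤1+k = record
  { length≡ = trans length⁺ (cong suc (sym (+-suc N k)))
  ; last≡   = trans (cong (λ j → (entries s ∷ʳ x) ! suc j) (+-suc N k)) new
  ; asc≡    = trans (asc-append-ascent (subst (_< x) (sym last≡) ℓ<x)) (cong suc asc≡)
  ; ascent  = trans isAscentSeq-append (cong₂ _∧_ ascent (≤ᵇ-true (subst (λ a → x ≤ suc a) (sym asc≡) x≤1+k)))
  ; avoids  = trans avoids120-append (cong₂ _∧_ avoids (trans (admits≡ x) (≤ᵇ-true (≤-trans m≤ℓ (<⇒≤ ℓ<x)))))
  ; admits≡ = λ y → trans (admits-append y) (newFloor y)
  ; m≤ℓ     = <⇒≤ ℓ<x
  ; ℓ≤k     = x≤1+k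
  }
  where
  open Sound S
  open Append (entries s) x length≡
  newFloor : ∀ y → admits (entries s) y ∧ not ((y <ᵇ entries s ! suc (N + k)) ∧ (entries s ! suc (N + k) <ᵇ x))
                   ≡ (ℓ ≤ᵇ y)
  newFloor y rewrite last≡ | <ᵇ-true ℓ<x | admits≡ y = admits-after-ascent y m≤ℓ

sound : (s : Built N k m ℓ) → Sound s
sound start = record
  { length≡ = refl ; last≡ = refl ; asc≡ = refl ; ascent = refl ; avoids = refl
  ; admits≡ = λ y → refl ; m≤ℓ = z≤n ; ℓ≤k = z≤n }
sound (descend s x m≤x x≤ℓ) = sound-descend (sound s) x m≤x x≤ℓ
sound (ascend s x ℓ<x x≤1+k) = sound-ascend (sound s) x ℓ<x x≤1+k

record Packed : Set where
  constructor ⟨_⟩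
  field
    {descents ascents floor lastEntry} : ℕ
    built : Built descents ascents floor lastEntry

packedEntries : Packed → List ℕ
packedEntries ⟨ s ⟩ = entries s

Derivation : List ℕ → Set
Derivation e = Σ[ t ∈ Packed ] packedEntries t ≡ e

extend : (s : Built N k m ℓ) (x : ℕ) → m ≤ x → x ≤ suc k → Derivation (entries s ∷ʳ x)
extend {ℓ = ℓ} s x m≤x x≤1+k with ℓ <? x
... | yes ℓ<x = ⟨ ascend s x ℓ<x x≤1+k ⟩ , refl
... | no ℓ≮x  = ⟨ descend s x m≤x (≮⇒≥ ℓ≮x) ⟩ , refl

derive-∷ʳ : ∀ {e} x → Derivation e → isAscentSeq (e ∷ʳ x) ≡ true → avoids120 (e ∷ʳ x) ≡ true →
            Derivation (e ∷ʳ x)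
derive-∷ʳ x (⟨ s ⟩ , refl) ascent⁺ avoids⁺ =
  extend s x (≤ᵇ-true⁻¹ (trans (sym (admits≡ x)) admits-x)) (subst (λ a → x ≤ suc a) asc≡ (≤ᵇ-true⁻¹ x≤1+asc))
  where
  open Sound (sound s) using (length≡; asc≡; admits≡)
  open Append (entries s) x length≡
  x≤1+asc : (x ≤ᵇ suc (asc (entries s))) ≡ true
  x≤1+asc = proj₂ (∧-true⁻¹ (trans (sym isAscentSeq-append) ascent⁺))
  admits-x : admits (entries s) x ≡ true
  admits-x = proj₂ (∧-true⁻¹ (trans (sym avoids120-append) avoids⁺))

derive : ∀ e → Reverse e → 1 ≤ length e → isAscentSeq e ≡ true → avoids120 e ≡ true → Derivation e
derive .[] [] () _ _
derive .([] ∷ʳ zero) ([] ∶ _ ∶ʳ zero) _ _ _ = ⟨ start ⟩ , refl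
derive .([] ∷ʳ suc x) ([] ∶ _ ∶ʳ suc x) _ () _
derive .((y ∷ ys) ∷ʳ x) ((y ∷ ys) ∶ r ∶ʳ x) _ ascent avoids
  with ∧-true⁻¹ (trans (sym (Append.isAscentSeq-append (y ∷ ys) x refl)) ascent)
     | ∧-true⁻¹ (trans (sym (Append.avoids120-append (y ∷ ys) x refl)) avoids)
... | ascent′ , _ | avoids′ , _ = derive-∷ʳ x (derive (y ∷ ys) r (s≤s z≤n) ascent′ avoids′) ascent avoids

entries-nonempty : (s : Built N k m ℓ) → [] ≢ entries s
entries-nonempty s eq with trans (cong length eq) (Sound.length≡ (sound s))
... | ()

entries-injective : (s : Built N k m ℓ) (s′ : Built N′ k′ m′ ℓ′) → entries s ≡ entries s′ → ⟨ s ⟩ ≡ ⟨ s′ ⟩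
entries-injective start start _ = refl
entries-injective start (descend s′ _ _ _) eq = contradiction (∷ʳ-injectiveˡ [] (entries s′) eq) (entries-nonempty s′)
entries-injective start (ascend s′ _ _ _) eq = contradiction (∷ʳ-injectiveˡ [] (entries s′) eq) (entries-nonempty s′)
entries-injective (descend s _ _ _) start eq = contradiction (sym (∷ʳ-injectiveˡ (entries s) [] eq)) (entries-nonempty s)
entries-injective (ascend s _ _ _) start eq = contradiction (sym (∷ʳ-injectiveˡ (entries s) [] eq)) (entries-nonempty s)
entries-injective (descend s x m≤x x≤ℓ) (descend s′ x′ m≤x′ x≤ℓ′) eq
  with ∷ʳ-injective (entries s) (entries s′) eq
... | eq′ , refl with entries-injective s s′ eq′
... | refl = cong₂ (λ a b → ⟨ descend s x a b ⟩) (≤-irrelevant m≤x m≤x′) (≤-irrelevant x≤ℓ x≤ℓ′)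
entries-injective (ascend s x ℓ<x x≤k) (ascend s′ x′ ℓ<x′ x≤k′) eq
  with ∷ʳ-injective (entries s) (entries s′) eq
... | eq′ , refl with entries-injective s s′ eq′
... | refl = cong₂ (λ a b → ⟨ ascend s x a b ⟩) (≤-irrelevant ℓ<x ℓ<x′) (≤-irrelevant x≤k x≤k′)
entries-injective (descend s x _ x≤ℓ) (ascend s′ x′ ℓ′<x′ _) eq
  with ∷ʳ-injective (entries s) (entries s′) eq
... | eq′ , refl with cong Packed.lastEntry (entries-injective s s′ eq′)
... | refl = contradiction x≤ℓ (<⇒≱ ℓ′<x′)
entries-injective (ascend s x ℓ<x _) (descend s′ x′ _ x′≤ℓ′) eq
  with ∷ʳ-injective (entries s) (entries s′) eq
... | eq′ , refl with cong Packed.lastEntry (entries-injective s s′ eq′)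
... | refl = contradiction x′≤ℓ′ (<⇒≱ ℓ<x)

InRange : ℕ → ℕ → (ℕ → Set) → Set
InRange a t B = Σ[ i ∈ ℕ ] (a ≤ i × i < a + t) × B i

bounds-irrelevant : ∀ {a t i} (p q : a ≤ i × i < a + t) → p ≡ q
bounds-irrelevant (p₁ , p₂) (q₁ , q₂) = cong₂ _,_ (≤-irrelevant p₁ q₁) (≤-irrelevant p₂ q₂)

Derivations : ℕ → ℕ → Set
Derivations N k = InRange 0 (suc k) λ ℓ → InRange 0 (suc ℓ) λ m → Built N k m ℓ

derivationEntries : Derivations N k → List ℕ
derivationEntries (_ , _ , _ , _ , s) = entries s

file : (s : Built N′ k′ m ℓ) → N′ ≡ N × k′ ≡ k → Derivations N k
file {m = m} {ℓ} s (refl , refl) = ℓ , (z≤n , s≤s ℓ≤k) , m , (z≤n , s≤s m≤ℓ) , s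
  where open Sound (sound s)

file-entries : (s : Built N′ k′ m ℓ) (eq : N′ ≡ N × k′ ≡ k) → derivationEntries (file s eq) ≡ entries s
file-entries s (refl , refl) = refl

file-self : (s : Built N k m ℓ) (eq : N ≡ N × k ≡ k) (r₁ : 0 ≤ ℓ × ℓ < suc k) (r₂ : 0 ≤ m × m < suc ℓ) →
            file s eq ≡ (ℓ , r₁ , m , r₂ , s)
file-self s (refl , refl) r₁ r₂ =
  cong₂ (λ a b → _ , a , _ , b , s) (bounds-irrelevant _ r₁) (bounds-irrelevant _ r₂)

indices-determined : (s : Built N′ k′ m ℓ) → length (entries s) ≡ suc (N + k) → asc (entries s) ≡ k →
                     N′ ≡ N × k′ ≡ k
indices-determined {N′} {k′} {N = N} {k} s length≡N+k asc≡k = N′≡N , k′≡k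
  where
  open Sound (sound s)
  k′≡k : k′ ≡ k
  k′≡k = trans (sym asc≡) asc≡k
  N′≡N : N′ ≡ N
  N′≡N = +-cancelʳ-≡ k N′ N (suc-injective (trans (sym (trans length≡ (cong (λ a → suc (N′ + a)) k′≡k))) length≡N+k))

fileDerivation : ∀ {e} → Derivation e → length e ≡ suc (N + k) → asc e ≡ k → Derivations N k
fileDerivation (⟨ s ⟩ , refl) p q = file s (indices-determined s p q)

fileDerivation-entries : ∀ {e} (d : Derivation e) (p : length e ≡ suc (N + k)) (q : asc e ≡ k) →
                         derivationEntries (fileDerivation d p q) ≡ e
fileDerivation-entries (⟨ s ⟩ , refl) p q = file-entries s (indices-determined s p q)

fileDerivation-unique : (s : Built N k m ℓ) → ∀ {e} (d : Derivation e) → e ≡ entries s →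
                        ∀ p q r₁ r₂ → fileDerivation d p q ≡ (ℓ , r₁ , m , r₂ , s)
fileDerivation-unique s (⟨ s′ ⟩ , refl) e≡ p q r₁ r₂ with entries-injective s′ s e≡
... | refl = file-self s _ r₁ r₂

asVector : (s : Built N k m ℓ) → Vec ℕ (suc (N + k))
asVector s = cast (Sound.length≡ (sound s)) (fromList (entries s))

toList-asVector : (s : Built N k m ℓ) → toList (asVector s) ≡ entries s
toList-asVector s = trans (toList-cast _ (fromList (entries s))) (toList∘fromList (entries s))

encode : Derivations N k → Counted (suc (N + k)) k
encode (_ , _ , _ , _ , s) =
  asVector s , trans (cong isAscentSeq same) ascent , trans (cong avoids120 same) avoids , trans (cong asc same) asc≡
  where
  open Sound (sound s)
  same : toList (asVector s) ≡ entries s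
  same = toList-asVector s

derivationOf : ∀ {n} → (c : Counted (suc n) k) → Derivation (toList (proj₁ c))
derivationOf (v , ascent , avoids , _) = derive (toList v) (reverseView (toList v)) nonempty ascent avoids
  where
  nonempty : 1 ≤ length (toList v)
  nonempty = subst (1 ≤_) (sym (length-toList v)) (s≤s z≤n)

decode : Counted (suc (N + k)) k → Derivations N k
decode c@(v , _ , _ , asc≡k) = fileDerivation (derivationOf c) (length-toList v) asc≡k

Counted-≡ : ∀ {n} (c c′ : Counted n k) → proj₁ c ≡ proj₁ c′ → c ≡ c′
Counted-≡ (v , a , b , d) (.v , a′ , b′ , d′) refl
  rewrite uip a a′ | uip b b′ | uip d d′ = refl

toList-encode : (d : Derivations N k) → toList (proj₁ (encode d)) ≡ derivationEntries d
toList-encode (_ , _ , _ , _ , s) = toList-asVector s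

vector-≡ : ∀ {n} {u v : Vec ℕ n} → toList u ≡ toList v → u ≡ v
vector-≡ {u = u} {v} eq = trans (sym (cast-is-id refl u)) (toList-injective refl u v eq)

derivations↔counted : ∀ N k → Derivations N k ↔ Counted (suc (N + k)) k
derivations↔counted N k = mk↔ₛ′ encode decode encode-decode decode-encode
  where
  encode-decode : ∀ c → encode (decode {N} {k} c) ≡ c
  encode-decode c@(v , _ , _ , asc≡k) = Counted-≡ _ c
    (vector-≡ (trans (toList-encode (decode c)) (fileDerivation-entries (derivationOf c) (length-toList v) asc≡k)))
  decode-encode : ∀ d → decode (encode {N} {k} d) ≡ d
  decode-encode d@(ℓ , r₁ , m , r₂ , s) = fileDerivation-unique s (derivationOf (encode d)) (toList-asVector s) _ _ r₁ r₂

sumRange : ℕ → ℕ → (ℕ → ℕ) → ℕ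
sumRange a zero    F = 0
sumRange a (suc t) F = F a + sumRange (suc a) t F

guard : {P : Set} → Dec P → ℕ → ℕ
guard (yes _) a = a
guard (no _)  _ = 0

guard↔ : {P : Set} → (∀ (p q : P) → p ≡ q) → (d : Dec P) (a : ℕ) → Fin (guard d a) ↔ (P × Fin a)
guard↔ irr (yes p) a = mk↔ₛ′ (p ,_) proj₂ (λ { (q , i) → cong (_, i) (irr p q) }) (λ _ → refl)
guard↔ irr (no ¬p) a = mk↔ₛ′ (λ ()) (λ { (p , _) → contradiction p ¬p }) (λ { (p , _) → contradiction p ¬p }) (λ ())

InRange-split : ∀ a t (B : ℕ → Set) → (B a ⊎ InRange (suc a) t B) ↔ InRange a (suc t) B
InRange-split a t B = mk↔ₛ′ join split join-split split-join
  where
  widen : ∀ {i} → i < suc a + t → i < a + suc t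
  widen {i} = subst (i <_) (sym (+-suc a t))
  narrow : ∀ {i} → i < a + suc t → i < suc a + t
  narrow {i} = subst (i <_) (+-suc a t)
  join : B a ⊎ InRange (suc a) t B → InRange a (suc t) B
  join (inj₁ b)                    = a , (≤-refl , widen (s≤s (m≤m+n a t))) , b
  join (inj₂ (i , (a<i , i<) , b)) = i , (<⇒≤ a<i , widen i<) , b
  least : ∀ {i} → a ≡ i → B i → B a ⊎ InRange (suc a) t B
  least refl b = inj₁ b
  splitAt : ∀ i → a ≤ i × i < a + suc t → B i → Dec (a < i) → B a ⊎ InRange (suc a) t B
  splitAt i (_ , i<) b (yes a<i)  = inj₂ (i , (a<i , narrow i<) , b)
  splitAt i (a≤i , _) b (no a≮i) = least (≤-antisym a≤i (≮⇒≥ a≮i)) b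
  split : InRange a (suc t) B → B a ⊎ InRange (suc a) t B
  split (i , bnd , b) = splitAt i bnd b (a <? i)
  join-least : ∀ {i} (eq : a ≡ i) bnd (b : B i) → join (least eq b) ≡ (i , bnd , b)
  join-least refl bnd b = cong (λ r → a , r , b) (bounds-irrelevant _ bnd)
  join-split : ∀ r → join (split r) ≡ r
  join-split (i , bnd , b) with a <? i
  ... | yes _   = cong (λ r → i , r , b) (bounds-irrelevant _ bnd)
  ... | no a≮i  = join-least (≤-antisym (proj₁ bnd) (≮⇒≥ a≮i)) bnd b
  least-refl : (eq : a ≡ a) (b : B a) → least eq b ≡ inj₁ b
  least-refl refl b = refl
  split-join : ∀ r → split (join r) ≡ r
  split-join (inj₁ b) with a <? a
  ... | yes a<a = contradiction a<a (<-irrefl refl)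
  ... | no a≮a  = least-refl _ b
  split-join (inj₂ (i , (a<i , i<) , b)) with a <? i
  ... | yes _   = cong (λ r → inj₂ (i , r , b)) (bounds-irrelevant _ _)
  ... | no a≮i  = contradiction a<i a≮i

sum↔ : ∀ a t (F : ℕ → ℕ) (B : ℕ → Set) → (∀ i → Fin (F i) ↔ B i) → Fin (sumRange a t F) ↔ InRange a t B
sum↔ a zero F B _ = mk↔ₛ′ (λ ()) (⊥-elim ∘ empty) (⊥-elim ∘ empty) (λ ())
  where
  empty : InRange a 0 B → ⊥
  empty (i , (a≤i , i<a+0) , _) = ≤⇒≯ (subst (_≤ i) (sym (+-identityʳ a)) a≤i) i<a+0
sum↔ a (suc t) F B F↔B = ↔-trans +↔⊎ (↔-trans (F↔B a ⊎-↔ sum↔ (suc a) t F B F↔B) (InRange-split a t B))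

startCount : ℕ → ℕ → ℕ → ℕ → ℕ
startCount zero zero zero zero = 1
startCount _    _    _    _    = 0

mutual
  count : ℕ → ℕ → ℕ → ℕ → ℕ
  count N k m x = startCount N k m x + (descentCount N k m x + ascentCount N k m x)

  descentCount : ℕ → ℕ → ℕ → ℕ → ℕ
  descentCount zero    k m x = 0
  descentCount (suc N) k m x = guard (m ≤? x) (sumRange x (suc k ∸ x) λ ℓ → count N k m ℓ)

  -- the (k + 1)-st ascent, from m to x ∈ (m, k + 1]; m becomes the floor and
  -- the previous floor is any m′ ≤ m
  ascentCount : ℕ → ℕ → ℕ → ℕ → ℕ
  ascentCount N zero    m x = 0
  ascentCount N (suc k) m x = guard (m <? x) (guard (x ≤? suc k) (sumRange 0 (suc m) λ m′ → count N k m′ m))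

Start : ℕ → ℕ → ℕ → ℕ → Set
Start zero zero zero zero = ⊤
Start _    _    _    _    = ⊥

Descents : ℕ → ℕ → ℕ → ℕ → Set
Descents zero    k m x = ⊥
Descents (suc N) k m x = m ≤ x × InRange x (suc k ∸ x) (λ ℓ → Built N k m ℓ)

Ascents : ℕ → ℕ → ℕ → ℕ → Set
Ascents N zero    m x = ⊥
Ascents N (suc k) m x = m < x × (x ≤ suc k × InRange 0 (suc m) (λ m′ → Built N k m′ m))

lastStep : ∀ N k m x → Built N k m x ↔ (Start N k m x ⊎ (Descents N k m x ⊎ Ascents N k m x))
lastStep N k m x = mk↔ₛ′ split (join N k m x) split-join join-split
  where
  split : ∀ {N k m x} → Built N k m x → Start N k m x ⊎ (Descents N k m x ⊎ Ascents N k m x)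
  split start = inj₁ tt
  split {k = k} (descend {ℓ = ℓ} s x m≤x x≤ℓ) = inj₂ (inj₁ (m≤x , ℓ , (x≤ℓ , ℓ<x+[1+k∸x]) , s))
    where
    ℓ≤k : ℓ ≤ k
    ℓ≤k = Sound.ℓ≤k (sound s)
    ℓ<x+[1+k∸x] : ℓ < x + (suc k ∸ x)
    ℓ<x+[1+k∸x] = subst (ℓ <_) (sym (m+[n∸m]≡n (≤-trans x≤ℓ (m≤n⇒m≤1+n ℓ≤k)))) (s≤s ℓ≤k)
  split (ascend s x ℓ<x x≤1+k) = inj₂ (inj₂ (ℓ<x , x≤1+k , _ , (z≤n , s≤s (Sound.m≤ℓ (sound s))) , s))
  joinStart : ∀ N k m x → Start N k m x → Built N k m x
  joinStart zero zero zero zero tt = start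
  joinDescent : ∀ N k m x → Descents N k m x → Built N k m x
  joinDescent (suc N) k m x (m≤x , ℓ , (x≤ℓ , _) , s) = descend s x m≤x x≤ℓ
  joinAscent : ∀ N k m x → Ascents N k m x → Built N k m x
  joinAscent N (suc k) m x (m<x , x≤1+k , _ , _ , s) = ascend s x m<x x≤1+k
  join : ∀ N k m x → Start N k m x ⊎ (Descents N k m x ⊎ Ascents N k m x) → Built N k m x
  join N k m x (inj₁ d)        = joinStart N k m x d
  join N k m x (inj₂ (inj₁ d)) = joinDescent N k m x d
  join N k m x (inj₂ (inj₂ d)) = joinAscent N k m x d
  split-joinStart : ∀ N k m x d → split (joinStart N k m x d) ≡ inj₁ d
  split-joinStart zero zero zero zero tt = refl
  split-joinDescent : ∀ N k m x d → split (joinDescent N k m x d) ≡ inj₂ (inj₁ d)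
  split-joinDescent (suc N) k m x (m≤x , ℓ , bnd , s) = cong (λ r → inj₂ (inj₁ (m≤x , ℓ , r , s))) (bounds-irrelevant _ bnd)
  split-joinAscent : ∀ N k m x d → split (joinAscent N k m x d) ≡ inj₂ (inj₂ d)
  split-joinAscent N (suc k) m x (m<x , x≤1+k , m′ , bnd , s) = cong (λ r → inj₂ (inj₂ (m<x , x≤1+k , m′ , r , s))) (bounds-irrelevant _ bnd)
  split-join : ∀ d → split (join N k m x d) ≡ d
  split-join (inj₁ d)        = split-joinStart N k m x d
  split-join (inj₂ (inj₁ d)) = split-joinDescent N k m x d
  split-join (inj₂ (inj₂ d)) = split-joinAscent N k m x d
  join-split : ∀ s → join N k m x (split s) ≡ s
  join-split start = refl
  join-split (descend s x m≤x x≤ℓ) = refl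
  join-split (ascend s x ℓ<x x≤1+k) = refl

startCount↔ : ∀ N k m x → Fin (startCount N k m x) ↔ Start N k m x
startCount↔ zero    zero    zero    zero    = mk↔ₛ′ (λ _ → tt) (λ _ → zero) (λ _ → refl) (λ { zero → refl })
startCount↔ zero    zero    zero    (suc x) = 0↔⊥
startCount↔ zero    zero    (suc m) x       = 0↔⊥
startCount↔ zero    (suc k) m       x       = 0↔⊥
startCount↔ (suc N) k       m       x       = 0↔⊥

mutual
  count↔ : ∀ N k m x → Fin (count N k m x) ↔ Built N k m x
  count↔ N k m x =
    ↔-trans +↔⊎ (↔-trans (startCount↔ N k m x ⊎-↔ ↔-trans +↔⊎ (descentCount↔ N k m x ⊎-↔ ascentCount↔ N k m x))
                         (↔-sym (lastStep N k m x)))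

  descentCount↔ : ∀ N k m x → Fin (descentCount N k m x) ↔ Descents N k m x
  descentCount↔ zero    k m x = 0↔⊥
  descentCount↔ (suc N) k m x =
    ↔-trans (guard↔ ≤-irrelevant (m ≤? x) _) (↔-refl ×-↔ sum↔ x (suc k ∸ x) _ _ (λ ℓ → count↔ N k m ℓ))

  ascentCount↔ : ∀ N k m x → Fin (ascentCount N k m x) ↔ Ascents N k m x
  ascentCount↔ N zero    m x = 0↔⊥
  ascentCount↔ N (suc k) m x =
    ↔-trans (guard↔ ≤-irrelevant (m <? x) _)
            (↔-refl ×-↔ ↔-trans (guard↔ ≤-irrelevant (x ≤? suc k) _)
                                (↔-refl ×-↔ sum↔ 0 (suc m) _ _ (λ m′ → count↔ N k m′ m)))

total : ℕ → ℕ → ℕ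
total N k = sumRange 0 (suc k) λ ℓ → sumRange 0 (suc ℓ) λ m → count N k m ℓ

total↔ : ∀ N k → Fin (total N k) ↔ Derivations N k
total↔ N k = sum↔ 0 (suc k) _ _ λ ℓ → sum↔ 0 (suc ℓ) _ _ λ m → count↔ N k m ℓ

-- Counting series: the N-th coefficient of g counts objects with N weak descents.
Series : Set
Series = ℕ → ℕ

-- Partial sums, i.e. multiplication of the generating function by 1/(1 - z).
cumul : Series → Series
cumul g zero    = g zero
cumul g (suc N) = cumul g N + g (suc N)

cumul^ : ℕ → Series → Series
cumul^ zero    g = g
cumul^ (suc e) g = cumul (cumul^ e g)

cumul-cong : ∀ {f g} → f ≗ g → cumul f ≗ cumul g
cumul-cong f≗g zero    = f≗g zero
cumul-cong f≗g (suc N) = cong₂ _+_ (cumul-cong f≗g N) (f≗g (suc N))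

cumul^-cong : ∀ e {f g} → f ≗ g → cumul^ e f ≗ cumul^ e g
cumul^-cong zero    f≗g = f≗g
cumul^-cong (suc e) f≗g = cumul-cong (cumul^-cong e f≗g)

cumul^-+ : ∀ a b g → cumul^ a (cumul^ b g) ≗ cumul^ (a + b) g
cumul^-+ zero    b g N = refl
cumul^-+ (suc a) b g   = cumul-cong (cumul^-+ a b g)

cumul^-comm : ∀ a b g → cumul^ a (cumul^ b g) ≗ cumul^ b (cumul^ a g)
cumul^-comm a b g N = begin
  cumul^ a (cumul^ b g) N ≡⟨ cumul^-+ a b g N ⟩
  cumul^ (a + b) g N      ≡⟨ cong (λ e → cumul^ e g N) (+-comm a b) ⟩
  cumul^ (b + a) g N      ≡⟨ cumul^-+ b a g N ⟨
  cumul^ b (cumul^ a g) N ∎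
  where open ≡-Reasoning

cumul-+ : ∀ f g → cumul (λ N → f N + g N) ≗ (λ N → cumul f N + cumul g N)
cumul-+ f g zero    = refl
cumul-+ f g (suc N) = trans (cong (_+ (f (suc N) + g (suc N))) (cumul-+ f g N))
                            (interchange (cumul f N) (cumul g N) (f (suc N)) (g (suc N)))
  where
  interchange : ∀ a b c d → (a + b) + (c + d) ≡ (a + c) + (b + d)
  interchange = solve-∀

cumul^-+ˢ : ∀ e f g → cumul^ e (λ N → f N + g N) ≗ (λ N → cumul^ e f N + cumul^ e g N)
cumul^-+ˢ zero    f g N = refl
cumul^-+ˢ (suc e) f g N = trans (cumul-cong (cumul^-+ˢ e f g) N) (cumul-+ (cumul^ e f) (cumul^ e g) N)

cumul^-zero : ∀ e g → g ≗ (λ _ → 0) → cumul^ e g ≗ (λ _ → 0)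
cumul^-zero zero    g g≗0 = g≗0
cumul^-zero (suc e) g g≗0 = cumul-zero (cumul^-zero e g g≗0)
  where
  cumul-zero : ∀ {h} → h ≗ (λ _ → 0) → cumul h ≗ (λ _ → 0)
  cumul-zero h≗0 zero    = h≗0 zero
  cumul-zero h≗0 (suc N) = cong₂ _+_ (cumul-zero h≗0 N) (h≗0 (suc N))

cumul^-at-0 : ∀ e g → cumul^ e g 0 ≡ g 0
cumul^-at-0 zero    g = refl
cumul^-at-0 (suc e) g = cumul^-at-0 e g

sumRange-cong : ∀ a t {F G : ℕ → ℕ} → (∀ i → a ≤ i → i < a + t → F i ≡ G i) → sumRange a t F ≡ sumRange a t G
sumRange-cong a zero    h = refl
sumRange-cong a (suc t) h =
  cong₂ _+_ (h a ≤-refl (subst (a <_) (sym (+-suc a t)) (s≤s (m≤m+n a t))))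
            (sumRange-cong (suc a) t (λ i a<i i< → h i (<⇒≤ a<i) (subst (i <_) (sym (+-suc a t)) i<)))

sumRange-last : ∀ a t F → sumRange a (suc t) F ≡ sumRange a t F + F (a + t)
sumRange-last a zero    F = trans (+-identityʳ (F a)) (cong F (sym (+-identityʳ a)))
sumRange-last a (suc t) F = begin
  F a + sumRange (suc a) (suc t) F       ≡⟨ cong (F a +_) (sumRange-last (suc a) t F) ⟩
  F a + (sumRange (suc a) t F + F (suc a + t)) ≡⟨ +-assoc (F a) _ _ ⟨
  F a + sumRange (suc a) t F + F (suc a + t)   ≡⟨ cong (λ i → F a + sumRange (suc a) t F + F i) (sym (+-suc a t)) ⟩
  F a + sumRange (suc a) t F + F (a + suc t)   ∎
  where open ≡-Reasoning

sumRange-+ : ∀ a t (F G : ℕ → ℕ) → sumRange a t (λ i → F i + G i) ≡ sumRange a t F + sumRange a t G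
sumRange-+ a zero    F G = refl
sumRange-+ a (suc t) F G =
  trans (cong (F a + G a +_) (sumRange-+ (suc a) t F G)) (interchange (F a) (G a) (sumRange (suc a) t F) (sumRange (suc a) t G))
  where
  interchange : ∀ a b c d → (a + b) + (c + d) ≡ (a + c) + (b + d)
  interchange = solve-∀

cumul^-sumRange : ∀ e a t (G : ℕ → Series) →
                  cumul^ e (λ N → sumRange a t (λ i → G i N)) ≗ (λ N → sumRange a t (λ i → cumul^ e (G i) N))
cumul^-sumRange e a zero    G = cumul^-zero e _ (λ _ → refl)
cumul^-sumRange e a (suc t) G N =
  trans (cumul^-+ˢ e (G a) (λ N → sumRange (suc a) t (λ i → G i N)) N)
        (cong (cumul^ e (G a) N +_) (cumul^-sumRange e (suc a) t G N))

-- Telescoping: one more step after e-fold partial sums,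
--   cumul^ e g (N + 1) = g (N + 1) + Σ_{j = 1}^{e} cumul^ j g N,
-- with j written as a + e ∸ ℓ for ℓ ∈ [a, a + e).
cumul^-suc : ∀ e a g N → cumul^ e g (suc N) ≡ g (suc N) + sumRange a e (λ ℓ → cumul^ (a + e ∸ ℓ) g N)
cumul^-suc zero    a g N = sym (+-identityʳ (g (suc N)))
cumul^-suc (suc e) a g N = begin
  cumul^ (suc e) g N + cumul^ e g (suc N)
    ≡⟨ cong (cumul^ (suc e) g N +_) (cumul^-suc e (suc a) g N) ⟩
  cumul^ (suc e) g N + (g (suc N) + sumRange (suc a) e (λ ℓ → cumul^ (suc a + e ∸ ℓ) g N))
    ≡⟨ swap (cumul^ (suc e) g N) (g (suc N)) _ ⟩
  g (suc N) + (cumul^ (suc e) g N + sumRange (suc a) e (λ ℓ → cumul^ (suc a + e ∸ ℓ) g N))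
    ≡⟨ cong (g (suc N) +_) (cong₂ _+_ (cong (λ j → cumul^ j g N) (sym (m+n∸m≡n a (suc e))))
                                       (sumRange-cong (suc a) e (λ ℓ _ _ → cong (λ j → cumul^ (j ∸ ℓ) g N) (sym (+-suc a e))))) ⟩
  g (suc N) + sumRange a (suc e) (λ ℓ → cumul^ (a + suc e ∸ ℓ) g N) ∎
  where
  open ≡-Reasoning
  swap : ∀ x y z → x + (y + z) ≡ y + (x + z)
  swap = solve-∀

guard-yes : ∀ {P : Set} (d : Dec P) {a} → P → guard d a ≡ a
guard-yes (yes _) _ = refl
guard-yes (no ¬p) p = contradiction p ¬p

guard-no : ∀ {P : Set} (d : Dec P) {a} → ¬ P → guard d a ≡ 0
guard-no (yes p) ¬p = contradiction p ¬p
guard-no (no _)  _  = refl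

-- endAt k b: derivations with k ascents and last entry b (any floor);
-- these are exactly the ones an ascent with new floor b can start from.
endAt : ℕ → ℕ → Series
endAt k b N = sumRange 0 (suc b) (λ m → count N k m b)

endBelow : ℕ → ℕ → Series
endBelow k c N = sumRange 0 (suc c) (λ b → endAt k b N)

-- Above the floor, the last entry x of a derivation with k + 1 ascents is
-- reached by an ascent from m to some t ∈ [x, k + 1] followed by weak
-- descents within [x, t]; in series form this is a (k + 2 - x)-fold partial sum.
count-above-floor : ∀ k m x N → m < x → x ≤ suc k → count N (suc k) m x ≡ cumul^ (suc (suc k) ∸ x) (endAt k m) N
count-above-floor k m x zero m<x x≤1+k =
  trans (guard-yes (m <? x) m<x) (trans (guard-yes (x ≤? suc k) x≤1+k) (sym (cumul^-at-0 (suc (suc k) ∸ x) (endAt k m))))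
count-above-floor k m x (suc N) m<x x≤1+k = begin
  guard (m ≤? x) (sumRange x d (λ ℓ → count N (suc k) m ℓ)) + guard (m <? x) (guard (x ≤? suc k) (endAt k m (suc N)))
    ≡⟨ cong₂ _+_ (guard-yes (m ≤? x) (<⇒≤ m<x)) (trans (guard-yes (m <? x) m<x) (guard-yes (x ≤? suc k) x≤1+k)) ⟩
  sumRange x d (λ ℓ → count N (suc k) m ℓ) + endAt k m (suc N)
    ≡⟨ cong (_+ endAt k m (suc N)) (sumRange-cong x d (λ ℓ x≤ℓ ℓ< →
         trans (count-above-floor k m ℓ N (<-≤-trans m<x x≤ℓ) (≤-pred (subst (ℓ <_) x+d≡ ℓ<)))
               (cong (λ j → cumul^ (j ∸ ℓ) (endAt k m) N) (sym x+d≡)))) ⟩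
  sumRange x d (λ ℓ → cumul^ (x + d ∸ ℓ) (endAt k m) N) + endAt k m (suc N)
    ≡⟨ +-comm _ (endAt k m (suc N)) ⟩
  endAt k m (suc N) + sumRange x d (λ ℓ → cumul^ (x + d ∸ ℓ) (endAt k m) N)
    ≡⟨ cumul^-suc d x (endAt k m) N ⟨
  cumul^ d (endAt k m) (suc N) ∎
  where
  open ≡-Reasoning
  d : ℕ
  d = suc (suc k) ∸ x
  x+d≡ : x + d ≡ suc (suc k)
  x+d≡ = m+[n∸m]≡n (m≤n⇒m≤1+n x≤1+k)

-- The floor is the lower entry of an ascent ending at most at k + 1, so after
-- k + 1 ascents it cannot be k + 1.
count-top-floor : ∀ k N → count N (suc k) (suc k) (suc k) ≡ 0
count-top-floor k zero    = guard-no (suc k <? suc k) (<-irrefl refl)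
count-top-floor k (suc N) =
  trans (cong₂ _+_ (trans (guard-yes (suc k ≤? suc k) ≤-refl)
                          (cong (λ t → sumRange (suc k) t (λ ℓ → count N (suc k) (suc k) ℓ)) (m+n∸n≡m 1 (suc k))))
                   (guard-no (suc k <? suc k) (<-irrefl refl)))
        (cong (λ c → c + 0 + 0) (count-top-floor k N))

-- At the floor (x = m) the last entry is reached by weak descents only, and
-- the count falls short of the formula of count-above-floor by cumul (endAt k m).
count-at-floor : ∀ k m → m ≤ k → ∀ N → count N (suc k) m m + cumul (endAt k m) N ≡ cumul^ (suc (suc k) ∸ m) (endAt k m) N
count-at-floor k m m≤k zero =
  trans (cong (_+ endAt k m 0) (guard-no (m <? m) (<-irrefl refl))) (sym (cumul^-at-0 (suc (suc k) ∸ m) (endAt k m)))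
count-at-floor k m m≤k (suc N) = begin
  (guard (m ≤? m) (sumRange m d (λ ℓ → count N K m ℓ)) + guard (m <? m) (guard (m ≤? K) (f (suc N)))) + (cumul f N + f (suc N))
    ≡⟨ cong₂ (λ a b → (a + b) + (cumul f N + f (suc N)))
             (trans (guard-yes (m ≤? m) ≤-refl) (cong (λ t → sumRange m t (λ ℓ → count N K m ℓ)) d≡))
             (guard-no (m <? m) (<-irrefl refl)) ⟩
  (count N K m m + sumRange (suc m) d′ (λ ℓ → count N K m ℓ) + 0) + (cumul f N + f (suc N))
    ≡⟨ rearrange (count N K m m) _ (cumul f N) (f (suc N)) ⟩
  f (suc N) + ((count N K m m + cumul f N) + sumRange (suc m) d′ (λ ℓ → count N K m ℓ))
    ≡⟨ cong (λ c → f (suc N) + (c + sumRange (suc m) d′ (λ ℓ → count N K m ℓ))) (count-at-floor k m m≤k N) ⟩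
  f (suc N) + (cumul^ d f N + sumRange (suc m) d′ (λ ℓ → count N K m ℓ))
    ≡⟨ cong (λ c → f (suc N) + c)
         (cong₂ _+_ (cong (λ j → cumul^ j f N) (sym (m+n∸m≡n m d)))
                    (sumRange-cong (suc m) d′ (λ ℓ m<ℓ ℓ< →
                       trans (count-above-floor k m ℓ N m<ℓ (≤-pred (subst (ℓ <_) m+d≡′ ℓ<)))
                             (cong (λ j → cumul^ (j ∸ ℓ) f N) (sym m+d≡))))) ⟩
  f (suc N) + sumRange m (suc d′) (λ ℓ → cumul^ (m + d ∸ ℓ) f N)
    ≡⟨ cong (λ t → f (suc N) + sumRange m t (λ ℓ → cumul^ (m + d ∸ ℓ) f N)) (sym d≡) ⟩
  f (suc N) + sumRange m d (λ ℓ → cumul^ (m + d ∸ ℓ) f N)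
    ≡⟨ cumul^-suc d m f N ⟨
  cumul^ d f (suc N) ∎
  where
  open ≡-Reasoning
  K d d′ : ℕ
  K = suc k
  d = suc K ∸ m
  d′ = K ∸ m
  f : Series
  f = endAt k m
  m≤K : m ≤ K
  m≤K = m≤n⇒m≤1+n m≤k
  d≡ : d ≡ suc d′
  d≡ = +-∸-assoc 1 m≤K
  m+d≡ : m + d ≡ suc K
  m+d≡ = m+[n∸m]≡n (m≤n⇒m≤1+n m≤K)
  m+d≡′ : suc m + d′ ≡ suc K
  m+d≡′ = cong suc (m+[n∸m]≡n m≤K)
  rearrange : ∀ a s y z → (a + s + 0) + (y + z) ≡ z + ((a + y) + s)
  rearrange = solve-∀

endAt-suc : ∀ k b → b ≤ k → cumul^ b (endAt k b) ≗ endBelow k b →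
            ∀ N → endAt (suc k) b N + cumul (endAt k b) N ≡ cumul^ (suc (suc k)) (endAt k b) N
endAt-suc k b b≤k IH N = begin
  endAt K b N + cumul (endAt k b) N
    ≡⟨ cong (_+ cumul (endAt k b) N) (sumRange-last 0 b (λ m → count N K m b)) ⟩
  (sumRange 0 b (λ m → count N K m b) + count N K b b) + cumul (endAt k b) N
    ≡⟨ +-assoc (sumRange 0 b (λ m → count N K m b)) _ _ ⟩
  sumRange 0 b (λ m → count N K m b) + (count N K b b + cumul (endAt k b) N)
    ≡⟨ cong₂ _+_ (trans (sumRange-cong 0 b (λ m _ m<b → count-above-floor k m b N m<b b≤K))
                        (sym (cumul^-sumRange E 0 b (endAt k) N)))
                 (count-at-floor k b b≤k N) ⟩
  cumul^ E (λ M → sumRange 0 b (λ m → endAt k m M)) N + cumul^ E (endAt k b) N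
    ≡⟨ cumul^-+ˢ E (λ M → sumRange 0 b (λ m → endAt k m M)) (endAt k b) N ⟨
  cumul^ E (λ M → sumRange 0 b (λ m → endAt k m M) + endAt k b M) N
    ≡⟨ cumul^-cong E (λ M → trans (sym (sumRange-last 0 b (λ m → endAt k m M))) (sym (IH M))) N ⟩
  cumul^ E (cumul^ b (endAt k b)) N
    ≡⟨ cumul^-+ E b (endAt k b) N ⟩
  cumul^ (E + b) (endAt k b) N
    ≡⟨ cong (λ j → cumul^ j (endAt k b) N) (m∸n+n≡m (m≤n⇒m≤1+n b≤K)) ⟩
  cumul^ (suc K) (endAt k b) N ∎
  where
  open ≡-Reasoning
  K E : ℕ
  K = suc k
  E = suc K ∸ b
  b≤K : b ≤ K
  b≤K = m≤n⇒m≤1+n b≤k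

-- Ending at the new maximal value k + 1: an ascent from any b ≤ k to k + 1.
endAt-top : ∀ k N → endAt (suc k) (suc k) N ≡ cumul (endBelow k k) N
endAt-top k N = begin
  endAt K K N
    ≡⟨ sumRange-last 0 K (λ m → count N K m K) ⟩
  sumRange 0 K (λ m → count N K m K) + count N K K K
    ≡⟨ cong₂ _+_ (sumRange-cong 0 K (λ m _ m<K → trans (count-above-floor k m K N m<K ≤-refl)
                                                      (cong (λ j → cumul^ j (endAt k m) N) (m+n∸n≡m 1 K))))
                 (count-top-floor k N) ⟩
  sumRange 0 K (λ m → cumul (endAt k m) N) + 0
    ≡⟨ +-identityʳ _ ⟩
  sumRange 0 K (λ m → cumul (endAt k m) N)
    ≡⟨ cumul^-sumRange 1 0 K (endAt k) N ⟨
  cumul (endBelow k k) N ∎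
  where
  open ≡-Reasoning
  K : ℕ
  K = suc k

endBelow-suc : ∀ k c → c ≤ k → (∀ b → b ≤ k → cumul^ b (endAt k b) ≗ endBelow k b) →
               ∀ N → endBelow (suc k) c N + cumul (endBelow k c) N ≡ cumul^ (suc (suc k)) (endBelow k c) N
endBelow-suc k c c≤k IH N = begin
  endBelow (suc k) c N + cumul (endBelow k c) N
    ≡⟨ cong (endBelow (suc k) c N +_) (cumul^-sumRange 1 0 (suc c) (endAt k) N) ⟩
  sumRange 0 (suc c) (λ b → endAt (suc k) b N) + sumRange 0 (suc c) (λ b → cumul (endAt k b) N)
    ≡⟨ sumRange-+ 0 (suc c) (λ b → endAt (suc k) b N) (λ b → cumul (endAt k b) N) ⟨
  sumRange 0 (suc c) (λ b → endAt (suc k) b N + cumul (endAt k b) N)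
    ≡⟨ sumRange-cong 0 (suc c) (λ b _ b< → endAt-suc k b (b≤k b<) (IH b (b≤k b<)) N) ⟩
  sumRange 0 (suc c) (λ b → cumul^ (suc (suc k)) (endAt k b) N)
    ≡⟨ cumul^-sumRange (suc (suc k)) 0 (suc c) (endAt k) N ⟨
  cumul^ (suc (suc k)) (endBelow k c) N ∎
  where
  open ≡-Reasoning
  b≤k : ∀ {b} → b < 0 + suc c → b ≤ k
  b≤k b< = ≤-trans (≤-pred b<) c≤k

endBelow-top : ∀ k → (∀ b → b ≤ k → cumul^ b (endAt k b) ≗ endBelow k b) →
               endBelow (suc k) (suc k) ≗ cumul^ (suc (suc k)) (endBelow k k)
endBelow-top k IH N =
  trans (sumRange-last 0 (suc k) (λ b → endAt (suc k) b N))
        (trans (cong (endBelow (suc k) k N +_) (endAt-top k N)) (endBelow-suc k k ≤-refl IH N))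

endBelow-endAt : ∀ k c → c ≤ k → cumul^ c (endAt k c) ≗ endBelow k c
endBelow-endAt zero    zero    _ N = sym (+-identityʳ _)
endBelow-endAt (suc k) c c≤1+k N with c ≤? k
... | yes c≤k = +-cancelʳ-≡ (cumul (endBelow k c) N) _ _ (begin
  cumul^ c (endAt (suc k) c) N + cumul (endBelow k c) N
    ≡⟨ cong (cumul^ c (endAt (suc k) c) N +_)
            (trans (cumul-cong (λ M → sym (IH c c≤k M)) N) (cumul^-comm 1 c (endAt k c) N)) ⟩
  cumul^ c (endAt (suc k) c) N + cumul^ c (cumul (endAt k c)) N
    ≡⟨ cumul^-+ˢ c (endAt (suc k) c) (cumul (endAt k c)) N ⟨
  cumul^ c (λ M → endAt (suc k) c M + cumul (endAt k c) M) N
    ≡⟨ cumul^-cong c (endAt-suc k c c≤k (IH c c≤k)) N ⟩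
  cumul^ c (cumul^ (suc (suc k)) (endAt k c)) N
    ≡⟨ cumul^-comm c (suc (suc k)) (endAt k c) N ⟩
  cumul^ (suc (suc k)) (cumul^ c (endAt k c)) N
    ≡⟨ cumul^-cong (suc (suc k)) (IH c c≤k) N ⟩
  cumul^ (suc (suc k)) (endBelow k c) N
    ≡⟨ endBelow-suc k c c≤k IH N ⟨
  endBelow (suc k) c N + cumul (endBelow k c) N ∎)
  where
  open ≡-Reasoning
  IH : ∀ c → c ≤ k → cumul^ c (endAt k c) ≗ endBelow k c
  IH = endBelow-endAt k
... | no c≰k with ≤-antisym c≤1+k (≰⇒> c≰k)
...   | refl = begin
  cumul^ (suc k) (endAt (suc k) (suc k)) N
    ≡⟨ cumul^-cong (suc k) (endAt-top k) N ⟩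
  cumul^ (suc k) (cumul (endBelow k k)) N
    ≡⟨ cumul^-+ (suc k) 1 (endBelow k k) N ⟩
  cumul^ (suc k + 1) (endBelow k k) N
    ≡⟨ cong (λ j → cumul^ j (endBelow k k) N) (+-comm (suc k) 1) ⟩
  cumul^ (suc (suc k)) (endBelow k k) N
    ≡⟨ endBelow-top k (endBelow-endAt k) N ⟨
  endBelow (suc k) (suc k) N ∎
  where open ≡-Reasoning

unit : Series
unit zero    = 1
unit (suc _) = 0

cumul-unit : ∀ N → cumul unit N ≡ 1
cumul-unit zero    = refl
cumul-unit (suc N) = trans (+-identityʳ _) (cumul-unit N)

-- Without ascents the only sequences are 0 0 … 0.
count-flat : ∀ N → count N 0 0 0 ≡ 1
count-flat zero    = refl
count-flat (suc N) = trans (guard-yes (0 ≤? 0) z≤n) (trans (+-identityʳ _) (trans (+-identityʳ _) (count-flat N)))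

-- triangle k + 1 = (k + 2 choose 2), the number of pairs 0 ≤ m ≤ ℓ ≤ k.
triangle : ℕ → ℕ
triangle zero    = 0
triangle (suc k) = suc (suc k) + triangle k

triangle-C : ∀ k → suc (triangle k) ≡ suc (suc k) C 2
triangle-C zero    = refl
triangle-C (suc k) = begin
  suc (suc (suc k) + triangle k)       ≡⟨ +-suc (suc (suc k)) (triangle k) ⟨
  suc (suc k) + suc (triangle k)       ≡⟨ cong₂ _+_ (sym (nC1≡n (suc (suc k)))) (triangle-C k) ⟩
  suc (suc k) C 1 + suc (suc k) C 2    ≡⟨ nCk+nC[k+1]≡[n+1]C[k+1] (suc (suc k)) 1 ⟩
  suc (suc (suc k)) C 2                ∎
  where open ≡-Reasoning

total-cumul : ∀ k → endBelow k k ≗ cumul^ (suc (triangle k)) unit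
total-cumul zero N =
  trans (+-identityʳ (endAt 0 0 N)) (trans (+-identityʳ (count N 0 0 0)) (trans (count-flat N) (sym (cumul-unit N))))
total-cumul (suc k) N = begin
  endBelow (suc k) (suc k) N                            ≡⟨ endBelow-top k (endBelow-endAt k) N ⟩
  cumul^ (suc (suc k)) (endBelow k k) N                 ≡⟨ cumul^-cong (suc (suc k)) (total-cumul k) N ⟩
  cumul^ (suc (suc k)) (cumul^ (suc (triangle k)) unit) N ≡⟨ cumul^-+ (suc (suc k)) (suc (triangle k)) unit N ⟩
  cumul^ (suc (suc k) + suc (triangle k)) unit N        ≡⟨ cong (λ j → cumul^ j unit N) (+-suc (suc (suc k)) (triangle k)) ⟩
  cumul^ (suc (triangle (suc k))) unit N                ∎
  where open ≡-Reasoning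

-- Hockey stick: (q+1)-fold partial sums of the unit series are binomials.
cumul^-unit : ∀ q N → cumul^ (suc q) unit N ≡ (q + N) C N
cumul^-unit zero    N = trans (cumul-unit N) (sym (nCn≡1 N))
cumul^-unit (suc q) N = trans (cumul-cong (cumul^-unit q) N) (hockey N)
  where
  hockey : ∀ N → cumul (λ M → (q + M) C M) N ≡ (suc q + N) C N
  hockey zero    = refl
  hockey (suc N) = begin
    cumul (λ M → (q + M) C M) N + (q + suc N) C suc N ≡⟨ cong₂ _+_ (hockey N) (cong (_C suc N) (+-suc q N)) ⟩
    (suc q + N) C N + (suc q + N) C suc N       ≡⟨ nCk+nC[k+1]≡[n+1]C[k+1] (suc q + N) N ⟩
    suc (suc q + N) C suc N                     ≡⟨ cong (λ a → suc a C suc N) (+-suc q N) ⟨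
    (suc q + suc N) C suc N                     ∎
    where open ≡-Reasoning

total≡T : ∀ N k → total N k ≡ T (suc (N + k)) k
total≡T N k = begin
  total N k                                   ≡⟨ total-cumul k N ⟩
  cumul^ (suc (triangle k)) unit N            ≡⟨ cumul^-unit (triangle k) N ⟩
  (triangle k + N) C N                        ≡⟨ cong₂ _C_ upper lower ⟩
  (suc (suc k) C 2 + suc (N + k) ∸ (k + 2)) C (suc (N + k) ∸ (k + 1)) ∎
  where
  open ≡-Reasoning
  lower : N ≡ suc (N + k) ∸ (k + 1)
  lower = sym (trans (cong (suc (N + k) ∸_) (+-comm k 1)) (m+n∸n≡m N k))
  upper : triangle k + N ≡ suc (suc k) C 2 + suc (N + k) ∸ (k + 2)
  upper = begin
    triangle k + N                                  ≡⟨ m+n∸n≡m (triangle k + N) (suc (suc k)) ⟨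
    triangle k + N + suc (suc k) ∸ suc (suc k)      ≡⟨ cong₂ _∸_ (regroup (triangle k) N k) (+-comm 2 k) ⟩
    suc (triangle k) + suc (N + k) ∸ (k + 2)        ≡⟨ cong (λ c → c + suc (N + k) ∸ (k + 2)) (triangle-C k) ⟩
    suc (suc k) C 2 + suc (N + k) ∸ (k + 2)         ∎
    where
    regroup : ∀ t N k → t + N + suc (suc k) ≡ suc t + suc (N + k)
    regroup = solve-∀

count-theorem : ∀ N k → Fin (T (suc (N + k)) k) ↔ Counted (suc (N + k)) k
count-theorem N k =
  ↔-trans (subst (λ c → Fin c ↔ Fin (total N k)) (total≡T N k) ↔-refl)
          (↔-trans (total↔ N k) (derivations↔counted N k))

mainTheorem1 : (n k : ℕ) → 1 ≤ n → k ≤ n ∸ 1 → Fin (T n k) ↔ Counted n k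
mainTheorem1 (suc n′) k _ k≤n′ =
  subst (λ n → Fin (T (suc n) k) ↔ Counted (suc n) k) (m∸n+n≡m k≤n′) (count-theorem (n′ ∸ k) k)
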